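{- Let $r\ge2$ and let $q>1$ be an integer. Let $F$ be the $2\times q$ matrix whose first row is all $0$'s and whose second row is all $1$'s. Then $\mathrm{forb}(m,r,\mathrm{Sym}(F))=\Theta(m)$.
   Context: An $r$-matrix is a matrix with entries in $\{0,1,\dots,r-1\}$; a matrix is simple if it has no repeated columns. $F\prec A$ means some submatrix of $A$ is a row and column permutation of $F$. $\mathrm{forb}(m,r,\mathcal F)$ is the maximum number of columns of a simple $m$-rowed $r$-matrix $A$ with $F\not\prec A$ for all $F\in\mathcal F$. For a $(0,1)$-matrix $F$, $F(i,j)$ replaces each $0$ by $i$ and each $1$ by $j$; $\mathrm{Sym}(F)=\{F(i,j):0\le i<j\le r-1\}$. Asymptotics are as $m\to\infty$ with $r,q$ fixed. -}

module Defs where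

open import Data.Nat using (ℕ; _<_; _≤_; _*_)
open import Data.Fin using (Fin; toℕ)
open import Data.Bool using (Bool; true; false)
open import Data.Product using (Σ; ∃; _×_)
open import Function.Definitions using (Injective)
open import Relation.Binary.PropositionalEquality using (_≡_)
open import Relation.Nullary using (¬_)

Matrix : ℕ → ℕ → ℕ → Set
Matrix r m n = Fin m → Fin n → Fin r

Simple : ∀ {r m n} → Matrix r m n → Set
Simple {m = m} A = ∀ j k → (∀ (i : Fin m) → A i j ≡ A i k) → j ≡ k

-- F ≺ A : some submatrix of A is a row and column permutation of F,
-- i.e. there are injective maps of rows and columns of F into A.
_≺_ : ∀ {r p q m n} → Matrix r p q → Matrix r m n → Set
_≺_ {p = p} {q} {m} {n} F A =
  Σ (Fin p → Fin m) λ ρ → Σ (Fin q → Fin n) λ γ →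
    Injective _≡_ _≡_ ρ × Injective _≡_ _≡_ γ ×
    (∀ i j → A (ρ i) (γ j) ≡ F i j)

subst01 : ∀ {r p q} → Fin r → Fin r → (Fin p → Fin q → Bool) → Matrix r p q
subst01 i j F a b with F a b
... | false = i
... | true  = j

AvoidsSym : ∀ {r p q m n} → (Fin p → Fin q → Bool) → Matrix r m n → Set
AvoidsSym {r} F A = ∀ (i j : Fin r) → toℕ i < toℕ j → ¬ (subst01 i j F ≺ A)

IsForbSym : (m r : ℕ) → ∀ {p q} → (Fin p → Fin q → Bool) → ℕ → Set
IsForbSym m r F N =
  (Σ (Matrix r m N) λ A → Simple A × AvoidsSym F A) ×
  (∀ n (A : Matrix r m n) → Simple A → AvoidsSym F A → n ≤ N)

F2 : (q : ℕ) → Fin 2 → Fin q → Bool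
F2 q Fin.zero    _ = false
F2 q (Fin.suc _) _ = true

module Submission where

-- Lower bound: the m × m identity matrix is simple and avoids every F(x,y)
-- with x < y, because y ≠ 0 occurs at most once in each of its rows.
--
-- Upper bound: give each column k of a simple Sym(F)-avoiding matrix A with
-- m rows the label (a, A 0 k, A a k), where a is a row in which column k
-- differs from its top entry (a = 0 if the column is constant).  If q
-- distinct columns shared a label, either they would all be constant and
-- equal (contradicting simplicity) or rows 0 and a would carry F(x,y) or
-- F(y,x).  So each label class has fewer than q columns and the generalised
-- pigeonhole principle bounds the number of columns by m · r² · q.
--
-- Existence of forb: containment of a configuration is decidable by
-- exhaustive search over finite function spaces, so the largest number of
-- columns of a good matrix, bounded as above, can be found by search.

open import Defs
open import Data.Nat using (ℕ; _<_; _≤_; _*_)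
open import Data.Product using (Σ; ∃; _×_)

open import Data.Nat using (zero; suc; _+_; _^_; _<?_; z≤n; s≤s)
open import Data.Nat.Properties
  using (≤-trans; ≤-reflexive; n≮0; m≤m+n; +-mono-≤; <⇒≤; ≰⇒>; ≤∧≢⇒<; m<1+n⇒m≤n;
         _≤?_; *-assoc; *-comm; *-monoʳ-≤; +-0-commutativeMonoid; module ≤-Reasoning)
open import Data.Fin using (Fin; zero; suc; toℕ; combine; finToFun; funToFin)
open import Data.Fin.Properties
  using (_≟_; any?; all?; ¬Fin0; 0≢1+n; combine-injective; finToFun-funToFin; <-cmp)
open import Data.Bool using (Bool)
open import Data.List using (List; []; _∷_; [_]; length; filter; allFin)
open import Data.List.Properties using (length-++; filter-++; filter-some; length-tabulate)
open import Data.List.Membership.Propositional using (_∈_)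
open import Data.List.Membership.Propositional.Properties using (∈-filter⁻)
open import Data.List.Relation.Unary.All as All using ()
open import Data.List.Relation.Unary.Any using (here; there)
open import Data.List.Relation.Unary.AllPairs using ([]; _∷_)
open import Data.List.Relation.Unary.Unique.Propositional using (Unique)
open import Data.List.Relation.Unary.Unique.Propositional.Properties using (allFin⁺; filter⁺)
open import Algebra.Properties.CommutativeMonoid.Sum +-0-commutativeMonoid
  using (sum; sum-syntax; ∑-distrib-+; sum-remove; sum-cong-≗)
open import Data.Product using (_,_; proj₁; proj₂)
open import Data.Empty using (⊥; ⊥-elim)
open import Function using (_∘_)
open import Function.Definitions using (Injective)
open import Relation.Binary using (tri<; tri≈; tri>)
open import Relation.Nullary using (Dec; yes; no)
open import Relation.Nullary.Decidable using (_×-dec_; _→-dec_; ¬?; map′; decidable-stable)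
open import Relation.Binary.PropositionalEquality
  using (_≡_; _≢_; _≗_; refl; sym; trans; cong; subst; module ≡-Reasoning)

distinctMembers : ∀ {A : Set} q (ys : List A) → Unique ys → q ≤ length ys →
  Σ (Fin q → A) λ γ → Injective _≡_ _≡_ γ × (∀ t → γ t ∈ ys)
distinctMembers zero ys _ _ = (λ ()) , (λ { {()} }) , λ ()
distinctMembers {A} (suc q) (y ∷ ys) (y∉ys ∷ unique) (s≤s q≤|ys|)
  with γ , γ-injective , γ∈ys ← distinctMembers q ys unique q≤|ys| = δ , δ-injective , δ∈ys
  where
  δ : Fin (suc q) → A
  δ zero    = y
  δ (suc t) = γ t
  δ-injective : Injective _≡_ _≡_ δ
  δ-injective {zero}  {zero}  _ = refl
  δ-injective {zero}  {suc t} e = ⊥-elim (All.lookup y∉ys (γ∈ys t) e)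
  δ-injective {suc t} {zero}  e = ⊥-elim (All.lookup y∉ys (γ∈ys t) (sym e))
  δ-injective {suc t} {suc u} e = cong suc (γ-injective e)
  δ∈ys : ∀ t → δ t ∈ (y ∷ ys)
  δ∈ys zero    = here refl
  δ∈ys (suc t) = there (γ∈ys t)

term≤sum : ∀ {L} (t : Fin L → ℕ) ℓ → t ℓ ≤ sum t
term≤sum {suc L} t ℓ = ≤-trans (m≤m+n (t ℓ) _) (≤-reflexive (sym (sum-remove {i = ℓ} t)))

module _ {n L : ℕ} (f : Fin n → Fin L) where

  fibre : Fin L → List (Fin n) → List (Fin n)
  fibre ℓ = filter (λ k → f k ≟ ℓ)

  -- Every member of a list lies in (at least) the fibre of its own label.
  fibres-cover : ∀ xs → length xs ≤ ∑[ ℓ < L ] length (fibre ℓ xs)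
  fibres-cover []       = z≤n
  fibres-cover (x ∷ xs) = begin
    1 + length xs
      ≤⟨ +-mono-≤ own-fibre (fibres-cover xs) ⟩
    ∑[ ℓ < L ] length (fibre ℓ [ x ]) + ∑[ ℓ < L ] length (fibre ℓ xs)
      ≡⟨ sym (∑-distrib-+ (λ ℓ → length (fibre ℓ [ x ])) (λ ℓ → length (fibre ℓ xs))) ⟩
    ∑[ ℓ < L ] (length (fibre ℓ [ x ]) + length (fibre ℓ xs))
      ≡⟨ sum-cong-≗ (λ ℓ → split ℓ) ⟩
    ∑[ ℓ < L ] length (fibre ℓ (x ∷ xs))
      ∎
    where
    open ≤-Reasoning
    split : ∀ ℓ → length (fibre ℓ [ x ]) + length (fibre ℓ xs) ≡ length (fibre ℓ (x ∷ xs))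
    split ℓ = sym (trans (cong length (filter-++ (λ k → f k ≟ ℓ) [ x ] xs)) (length-++ (fibre ℓ [ x ])))
    own-fibre : 1 ≤ ∑[ ℓ < L ] length (fibre ℓ [ x ])
    own-fibre = ≤-trans (filter-some (λ k → f k ≟ f x) (here refl))
      (term≤sum (λ ℓ → length (fibre ℓ [ x ])) (f x))

sum≤ : ∀ {L} (t : Fin L → ℕ) {q} → (∀ ℓ → t ℓ ≤ q) → sum t ≤ L * q
sum≤ {zero}  t bound = z≤n
sum≤ {suc L} t bound = +-mono-≤ (bound zero) (sum≤ (λ ℓ → t (suc ℓ)) (λ ℓ → bound (suc ℓ)))

pigeonhole : ∀ {n L} q (f : Fin n → Fin L) →
  (∀ ℓ (γ : Fin q → Fin n) → Injective _≡_ _≡_ γ → (∀ t → f (γ t) ≡ ℓ) → ⊥) →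
  n ≤ L * q
pigeonhole {n} {L} q f noClass = begin
  n                                              ≡⟨ sym (length-tabulate {n = n} (λ k → k)) ⟩
  length (allFin n)                              ≤⟨ fibres-cover f (allFin n) ⟩
  ∑[ ℓ < L ] length (fibre f ℓ (allFin n))      ≤⟨ sum≤ _ fibre-small ⟩
  L * q                                          ∎
  where
  open ≤-Reasoning
  fibre-small : ∀ ℓ → length (fibre f ℓ (allFin n)) ≤ q
  fibre-small ℓ with length (fibre f ℓ (allFin n)) ≤? q
  ... | yes small = small
  ... | no large
    with γ , γ-injective , γ∈fibre ← distinctMembers q (fibre f ℓ (allFin n))
           (filter⁺ (λ k → f k ≟ ℓ) (allFin⁺ n)) (<⇒≤ (≰⇒> large))
    = ⊥-elim (noClass ℓ γ γ-injective λ t →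
        proj₂ (∈-filter⁻ (λ k → f k ≟ ℓ) {xs = allFin n} (γ∈fibre t)))

rowPair : ∀ {m} → Fin m → Fin m → Fin 2 → Fin m
rowPair a b zero    = a
rowPair a b (suc _) = b

rowPair-injective : ∀ {m} {a b : Fin m} → a ≢ b → Injective _≡_ _≡_ (rowPair a b)
rowPair-injective a≢b {zero}     {zero}     _ = refl
rowPair-injective a≢b {zero}     {suc zero} e = ⊥-elim (a≢b e)
rowPair-injective a≢b {suc zero} {zero}     e = ⊥-elim (a≢b (sym e))
rowPair-injective a≢b {suc zero} {suc zero} _ = refl

copyOfF2 : ∀ {r m n q} (A : Matrix r m n) {a b x y} (γ : Fin q → Fin n) →
  a ≢ b → Injective _≡_ _≡_ γ →
  (∀ t → A a (γ t) ≡ x) → (∀ t → A b (γ t) ≡ y) → subst01 x y (F2 q) ≺ A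
copyOfF2 A γ a≢b γ-injective rowA rowB =
  rowPair _ _ , γ , rowPair-injective a≢b , γ-injective ,
  λ { zero t → rowA t ; (suc zero) t → rowB t }

twoConstantRows : ∀ {r m n q} (A : Matrix r m n) → AvoidsSym (F2 q) A →
  ∀ {a b x y} (γ : Fin q → Fin n) → a ≢ b → x ≢ y → Injective _≡_ _≡_ γ →
  (∀ t → A a (γ t) ≡ x) → (∀ t → A b (γ t) ≡ y) → ⊥
twoConstantRows A avoids {x = x} {y} γ a≢b x≢y γ-injective rowA rowB with <-cmp x y
... | tri< x<y _ _ = avoids x y x<y (copyOfF2 A γ a≢b γ-injective rowA rowB)
... | tri≈ _ x≡y _ = x≢y x≡y
... | tri> _ _ y<x = avoids y x y<x (copyOfF2 A γ (a≢b ∘ sym) γ-injective rowB rowA)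

module Labelling {r m n : ℕ} (A : Matrix r (suc m) n) where

  open ≡-Reasoning

  Constant : Fin n → Set
  Constant k = ∀ b → A b k ≡ A zero k

  -- A row in which column k differs from its top entry, if there is one:
  -- should column k agree with its top entry there, the column is constant.
  differingRow : ∀ k → Σ (Fin (suc m)) λ a → A a k ≡ A zero k → Constant k
  differingRow k with any? (λ a → ¬? (A a k ≟ A zero k))
  ... | yes (a , differs) = a , λ agrees → ⊥-elim (differs agrees)
  ... | no none = zero , λ _ b → decidable-stable (A b k ≟ A zero k) (λ differs → none (b , differs))

  row : Fin n → Fin (suc m)
  row k = proj₁ (differingRow k)

  label : Fin n → Fin (suc m * (r * r))
  label k = combine (row k) (combine (A zero k) (A (row k) k))

  same-label : ∀ k k₀ → label k ≡ label k₀ →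
    row k ≡ row k₀ × A zero k ≡ A zero k₀ × A (row k₀) k ≡ A (row k₀) k₀
  same-label k k₀ eq with rows , entries ← combine-injective (row k) _ (row k₀) _ eq
    with tops , others ← combine-injective (A zero k) _ (A zero k₀) _ entries =
    rows , tops , subst (λ a → A a k ≡ A (row k₀) k₀) rows others

  labelClassesSmall : ∀ {q} → Simple A → AvoidsSym (F2 (suc (suc q))) A →
    ∀ ℓ (γ : Fin (suc (suc q)) → Fin n) → Injective _≡_ _≡_ γ → (∀ t → label (γ t) ≡ ℓ) → ⊥
  labelClassesSmall simple avoids ℓ γ γ-injective labelled = byEntries (x ≟ y)
    where
    a = row (γ zero)
    x = A zero (γ zero)
    y = A a (γ zero)

    inClass : ∀ t → row (γ t) ≡ a × A zero (γ t) ≡ x × A a (γ t) ≡ y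
    inClass t = same-label (γ t) (γ zero) (trans (labelled t) (sym (labelled zero)))

    constantColumn : x ≡ y → ∀ t b → A b (γ t) ≡ x
    constantColumn x≡y t b with rows , tops , others ← inClass t =
      trans (proj₂ (differingRow (γ t)) agrees b) tops
      where
      agrees : A (row (γ t)) (γ t) ≡ A zero (γ t)
      agrees = begin
        A (row (γ t)) (γ t)  ≡⟨ cong (λ c → A c (γ t)) rows ⟩
        A a (γ t)            ≡⟨ others ⟩
        y                    ≡⟨ sym x≡y ⟩
        x                    ≡⟨ sym tops ⟩
        A zero (γ t)         ∎

    a≢0 : x ≢ y → a ≢ zero
    a≢0 x≢y a≡0 = x≢y (subst (λ c → A c (γ zero) ≡ y) a≡0 refl)

    byEntries : Dec (x ≡ y) → ⊥
    byEntries (yes x≡y) = 0≢1+n (γ-injective (simple (γ zero) (γ (suc zero)) λ b →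
      trans (constantColumn x≡y zero b) (sym (constantColumn x≡y (suc zero) b))))
    byEntries (no x≢y) = twoConstantRows A avoids γ (a≢0 x≢y) (x≢y ∘ sym) γ-injective
      (λ t → proj₂ (proj₂ (inClass t))) (λ t → proj₁ (proj₂ (inClass t)))

-- Bound on the number of columns of a simple Sym(F)-avoiding matrix with
-- m + 1 rows: at most (m + 1) · r² labels, each used by fewer than q columns.
columnBound : ∀ {r m n q} (A : Matrix r (suc m) n) → Simple A → AvoidsSym (F2 (suc (suc q))) A →
  n ≤ suc m * (r * r) * suc (suc q)
columnBound A simple avoids = pigeonhole _ label (labelClassesSmall simple avoids)
  where open Labelling A

identity : ∀ {r m} → Matrix (suc (suc r)) m m
identity i k with i ≟ k
... | yes _ = suc zero
... | no _  = zero

identity-diagonal : ∀ {r m} (k : Fin m) → identity {r} k k ≡ suc zero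
identity-diagonal k with k ≟ k
... | yes _   = refl
... | no k≢k = ⊥-elim (k≢k refl)

identity-nonzero : ∀ {r m} (i k : Fin m) {x} → identity {r} i k ≡ x → x ≢ zero → i ≡ k
identity-nonzero i k eq x≢0 with i ≟ k
... | yes i≡k = i≡k
... | no _    = ⊥-elim (x≢0 (sym eq))

identity-simple : ∀ {r m} → Simple (identity {r} {m})
identity-simple j k sameColumns =
  identity-nonzero j k (trans (sym (sameColumns j)) (identity-diagonal j)) (λ ())

-- In F(x,y) with x < y the value y ≠ 0 fills a whole row of q ≥ 2 columns,
-- while the identity matrix has a single nonzero entry per row.
identity-avoids : ∀ {r m q} → AvoidsSym (F2 (suc (suc q))) (identity {r} {m})
identity-avoids x y x<y (ρ , γ , _ , γ-injective , match) =
  0≢1+n (γ-injective (trans (sym (onDiagonal zero)) (onDiagonal (suc zero))))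
  where
  y≢0 : y ≢ zero
  y≢0 y≡0 = n≮0 (subst (λ z → toℕ x < toℕ z) y≡0 x<y)
  onDiagonal : ∀ t → ρ (suc zero) ≡ γ t
  onDiagonal t = identity-nonzero (ρ (suc zero)) (γ t) (match (suc zero) t) y≢0

Extensional : ∀ {A B : Set} → ((A → B) → Set) → Set
Extensional P = ∀ {f g} → f ≗ g → P f → P g

-- Existence of a function Fin n → Fin m with a decidable extensional property
-- is decidable: enumerate all such functions through their codes in Fin (m ^ n).
search : ∀ {n m} (P : (Fin n → Fin m) → Set) → Extensional P →
  (∀ f → Dec (P f)) → Dec (∃ P)
search {n} {m} P ext P? with any? (λ code → P? (finToFun {m} {n} code))
... | yes (code , p) = yes (finToFun code , p)
... | no none = no λ (f , p) → none (funToFin f , ext (λ i → sym (finToFun-funToFin f i)) p)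

injective? : ∀ {a b} (f : Fin a → Fin b) → Dec (Injective _≡_ _≡_ f)
injective? f = map′ (λ inj {x} {y} → inj x y) (λ inj x y → inj {x} {y})
  (all? λ x → all? λ y → (f x ≟ f y) →-dec (x ≟ y))

injective-resp : ∀ {a b} {f g : Fin a → Fin b} → f ≗ g → Injective _≡_ _≡_ f → Injective _≡_ _≡_ g
injective-resp f≗g inj {x} {y} e = inj (trans (f≗g x) (trans e (sym (f≗g y))))

≺? : ∀ {r p q m n} (F : Matrix r p q) (A : Matrix r m n) → Dec (F ≺ A)
≺? {p = p} {q} {m} {n} F A = search RowsFit rowsFit-ext
  (λ ρ → search (Fits ρ) (fits-ext ρ) (fits? ρ))
  where
  Fits : (Fin p → Fin m) → (Fin q → Fin n) → Set
  Fits ρ γ = Injective _≡_ _≡_ ρ × Injective _≡_ _≡_ γ × (∀ i j → A (ρ i) (γ j) ≡ F i j)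
  fits-ext : ∀ ρ → Extensional (Fits ρ)
  fits-ext ρ γ≗γ′ (ρ-inj , γ-inj , match) =
    ρ-inj , injective-resp γ≗γ′ γ-inj , λ i j → trans (cong (A (ρ i)) (sym (γ≗γ′ j))) (match i j)
  fits? : ∀ ρ γ → Dec (Fits ρ γ)
  fits? ρ γ = injective? ρ ×-dec (injective? γ ×-dec all? λ i → all? λ j → A (ρ i) (γ j) ≟ F i j)
  RowsFit : (Fin p → Fin m) → Set
  RowsFit ρ = ∃ (Fits ρ)
  rowsFit-ext : Extensional RowsFit
  rowsFit-ext ρ≗ρ′ (γ , ρ-inj , γ-inj , match) =
    γ , injective-resp ρ≗ρ′ ρ-inj , γ-inj , λ i j → trans (cong (λ a → A a (γ j)) (sym (ρ≗ρ′ i))) (match i j)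

simple? : ∀ {r m n} (A : Matrix r m n) → Dec (Simple A)
simple? A = all? λ j → all? λ k → all? (λ i → A i j ≟ A i k) →-dec (j ≟ k)

avoidsSym? : ∀ {r p q m n} (F : Fin p → Fin q → Bool) (A : Matrix r m n) → Dec (AvoidsSym F A)
avoidsSym? F A = all? λ i → all? λ j → (toℕ i <? toℕ j) →-dec ¬? (≺? (subst01 i j F) A)

_≋_ : ∀ {r m n} → Matrix r m n → Matrix r m n → Set
A ≋ B = ∀ i j → A i j ≡ B i j

-- Existence of a matrix with a decidable entrywise-invariant property is
-- decidable: search over the rows, each encoded by its code in Fin (r ^ n).
searchMatrix : ∀ {r m n} (P : Matrix r m n → Set) → (∀ {A B} → A ≋ B → P A → P B) →
  (∀ A → Dec (P A)) → Dec (∃ P)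
searchMatrix {r} {m} {n} P resp P?
  with search (λ rows → P (decode rows)) ext (λ rows → P? (decode rows))
  where
  decode : (Fin m → Fin (r ^ n)) → Matrix r m n
  decode rows i = finToFun (rows i)
  ext : Extensional (λ rows → P (decode rows))
  ext rows≗ = resp (λ i j → cong (λ row → finToFun row j) (rows≗ i))
... | yes (rows , p) = yes (_ , p)
... | no none =
  no λ (A , p) → none ((λ i → funToFin (A i)) , resp (λ i j → sym (finToFun-funToFin (A i) j)) p)

Good : ∀ {r p q m n} → (Fin p → Fin q → Bool) → Matrix r m n → Set
Good F A = Simple A × AvoidsSym F A

good-resp : ∀ {r p q m n} (F : Fin p → Fin q → Bool) {A B : Matrix r m n} → A ≋ B → Good F A → Good F B
good-resp F A≋B (simple , avoids) =
  (λ j k same → simple j k (λ i → trans (A≋B i j) (trans (same i) (sym (A≋B i k))))) ,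
  λ i j i<j (ρ , γ , ρ-inj , γ-inj , match) →
    avoids i j i<j (ρ , γ , ρ-inj , γ-inj , λ a b → trans (A≋B (ρ a) (γ b)) (match a b))

good? : ∀ {p q} m r n (F : Fin p → Fin q → Bool) → Dec (∃ λ (A : Matrix r m n) → Good F A)
good? m r n F = searchMatrix (Good F) (good-resp F) (λ A → simple? A ×-dec avoidsSym? F A)

largest : (P : ℕ → Set) → (∀ n → Dec (P n)) → ∀ B → P 0 → (∀ n → P n → n ≤ B) →
  Σ ℕ λ N → P N × (∀ n → P n → n ≤ N)
largest P P? zero    p₀ bounded = 0 , p₀ , bounded
largest P P? (suc B) p₀ bounded with P? (suc B)
... | yes p = suc B , p , bounded
... | no ¬p = largest P P? B p₀ λ n pn →
  m<1+n⇒m≤n (≤∧≢⇒< (bounded n pn) λ { refl → ¬p pn })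

emptyGood : ∀ {p q} m r (F : Fin p → Fin (suc q) → Bool) → ∃ λ (A : Matrix r m 0) → Good F A
emptyGood m r F = (λ _ ()) , (λ ()) , λ _ _ _ (_ , γ , _) → ¬Fin0 (γ zero)

forbExists : ∀ {p q} m r (F : Fin p → Fin (suc q) → Bool) B →
  (∀ n (A : Matrix r m n) → Simple A → AvoidsSym F A → n ≤ B) → Σ ℕ (IsForbSym m r F)
forbExists m r F B bounded
  with N , good , maximal ← largest (λ n → ∃ λ (A : Matrix r m n) → Good F A) (λ n → good? m r n F)
                              B (emptyGood m r F) (λ n (A , simple , avoids) → bounded n A simple avoids)
  = N , good , λ n A simple avoids → maximal n (A , simple , avoids)

mainTheorem17 : (r q : ℕ) → 2 ≤ r → 2 ≤ q →
    Σ ℕ λ a → Σ ℕ λ b → Σ ℕ λ c → Σ ℕ λ M →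
      0 < a × 0 < b ×
      (∀ m → M ≤ m →
        Σ ℕ (λ N → IsForbSym m r (F2 q) N) ×
        (∀ N → IsForbSym m r (F2 q) N → a * m ≤ b * N × N ≤ c * m))
mainTheorem17 r@(suc (suc _)) q@(suc (suc _)) (s≤s (s≤s z≤n)) (s≤s (s≤s z≤n)) =
  1 , 1 , r * r * q , 1 , s≤s z≤n , s≤s z≤n , bounds
  where
  bounds : ∀ m → 1 ≤ m →
    Σ ℕ (λ N → IsForbSym m r (F2 q) N) ×
    (∀ N → IsForbSym m r (F2 q) N → 1 * m ≤ 1 * N × N ≤ r * r * q * m)
  bounds m@(suc _) _ =
    forbExists m r (F2 q) (m * (r * r) * q) (λ _ A simple avoids → columnBound A simple avoids) ,
    λ N ((A , simple , avoids) , maximal) →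
      *-monoʳ-≤ 1 (maximal m identity identity-simple identity-avoids) ,
      ≤-trans (columnBound A simple avoids)
              (≤-reflexive (trans (*-assoc m (r * r) q) (*-comm m (r * r * q))))
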